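{- Let $n_1,n_2,n_3$ be integers with $\min\{n_1,n_2,n_3\}\geq6$. For $r,s,t\in\mathbb{Q}$ let $\phi_{(r,s,t)}(x)=\dfrac{rs\,x^3+s\,x+t}{x^2+1}$ and $\beta_{(r,s,t)}=r^{n_1}s^{n_2}t^{n_3}$. Then for all $r,s,t\in\mathbb{Q}$ the orbit $\mathcal{O}_{\phi_{(r,s,t)}}\big(\beta_{(r,s,t)}\big)$ contains only finitely many integers.
   Context: $\mathcal{O}_\phi(b)=\{b,\phi(b),\phi^2(b),\dots\}$. -}

module Defs where

open import Data.Nat using (ℕ; zero; suc)
open import Data.Integer using (ℤ)
open import Data.Rational using (ℚ; 0ℚ; 1ℚ; _+_; _*_; _÷_; _/_; NonZero; _≤_; nonNegative; nonPositive)
open import Data.Rational.Properties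
open import Data.Sum using (inj₁; inj₂)

_^_ : ℚ → ℕ → ℚ
x ^ zero  = 1ℚ
x ^ suc n = x * (x ^ n)

infixr 8 _^_

sq+1-nonZero : ∀ x → NonZero (x * x + 1ℚ)
sq+1-nonZero x with ≤-total 0ℚ x
... | inj₁ 0≤x =
  let instance _ = nonNegative 0≤x
      instance _ = nonNeg*nonNeg⇒nonNeg x x
      instance _ = nonNeg+pos⇒pos (x * x) 1ℚ
  in pos⇒nonZero (x * x + 1ℚ)
... | inj₂ x≤0 =
  let instance _ = nonPositive x≤0
      instance _ = nonPos*nonPos⇒nonPos x x
      instance _ = nonNeg+pos⇒pos (x * x) 1ℚ
  in pos⇒nonZero (x * x + 1ℚ)

φ : ℚ → ℚ → ℚ → ℚ → ℚ
φ r s t x = _÷_ (r * s * x ^ 3 + s * x + t) (x * x + 1ℚ) {{sq+1-nonZero x}}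

iter : (ℚ → ℚ) → ℕ → ℚ → ℚ
iter f zero    x = x
iter f (suc k) x = f (iter f k x)

β : ℕ → ℕ → ℕ → ℚ → ℚ → ℚ → ℚ
β n₁ n₂ n₃ r s t = r ^ n₁ * s ^ n₂ * t ^ n₃

-- If t = 0, then β = 0 is a fixed point of φ and the orbit is {0}.  If t ≠ 0, then φ itself takes
-- only finitely many integer values.  Clearing denominators, φ(a/b) ∈ ℤ with gcd(a, b) = 1 gives
-- F(a, b) ≡ 0 (mod a² + b²) for an integral binary cubic F(X, Y) = R X³ + S X Y² + T Y³.  Since
-- a² ≡ −b² modulo a² + b², this forces a² + b² to divide the resultant (R − S)² + T² of F(X, 1) and
-- X² + 1, which is nonzero because T ≠ 0.  Hence a and b, and with them x = a/b, range over a
-- finite set.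
module Submission where

open import Defs
open import Data.Nat using (ℕ; _≤_)
open import Data.Integer using (ℤ)
open import Data.Rational using (ℚ; _/_)
open import Data.List using (List)
open import Data.List.Membership.Propositional using (_∈_)
open import Data.Product using (Σ; _×_)
open import Relation.Binary.PropositionalEquality using (_≡_)

open import Data.Nat as ℕ using (zero; suc; s≤s; z≤n)
import Data.Nat.Properties as ℕ
import Data.Nat.Divisibility as ℕ
import Data.Nat.Coprimality as ℕ
open import Data.Integer as ℤ using (+_; -[1+_]; 0ℤ; ∣_∣)
import Data.Integer.Properties as ℤ
import Data.Integer.GCD as ℤ
open import Data.Integer.Coprimality using (Coprime; coprime-divisor)
open import Data.Integer.Divisibility using () renaming (_∣_ to _∣ᵤ_)
open import Data.Integer.Divisibility.Signed using (divides; ∣⇒∣ᵤ)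
open import Data.Rational using (mkℚ; ↥_; ↧_; ↧ₙ_; 0ℚ; 1ℚ; toℚᵘ; fromℚᵘ; _÷_; 1/_; NonZero)
open import Data.Rational.Properties
  using (toℚᵘ-injective; toℚᵘ-fromℚᵘ; fromℚᵘ-toℚᵘ; fromℚᵘ-cong; toℚᵘ-homo-+; toℚᵘ-homo-*;
         _≟_; ↥-/; ↥p/↧p≡p; ↥p≡0⇒p≡0; *-inverseˡ; *-identityʳ; *-assoc; *-zeroˡ; *-zeroʳ)
open import Data.Rational.Unnormalised as ℚᵘ using (mkℚᵘ; *≡*)
import Data.Rational.Unnormalised.Properties as ℚᵘ
import Data.Rational.Solver as ℚ-Solver
import Data.Integer.Solver as ℤ-Solver
open import Data.List using ([]; _∷_; _++_; map; upTo; cartesianProductWith)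
open import Data.List.Membership.Propositional.Properties
  using (∈-map⁺; ∈-++⁺ˡ; ∈-++⁺ʳ; ∈-upTo⁺; ∈-cartesianProductWith⁺)
open import Data.List.Relation.Unary.Any using (here; there)
open import Data.Product using (_,_; uncurry)
open import Data.Sum using (inj₁; inj₂)
open import Function using (_∘_)
open import Relation.Nullary using (¬_; yes; no)
open import Relation.Binary.PropositionalEquality using (refl; sym; trans; cong; cong₂; subst; module ≡-Reasoning)

module _ where
  open Data.Rational using (_+_; _*_)

  fromℚᵘ-homo-+ : ∀ p q → fromℚᵘ (p ℚᵘ.+ q) ≡ fromℚᵘ p + fromℚᵘ q
  fromℚᵘ-homo-+ p q = toℚᵘ-injective (begin
    toℚᵘ (fromℚᵘ (p ℚᵘ.+ q))                ≈⟨ toℚᵘ-fromℚᵘ (p ℚᵘ.+ q) ⟩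
    p ℚᵘ.+ q                                ≈⟨ ℚᵘ.+-cong (toℚᵘ-fromℚᵘ p) (toℚᵘ-fromℚᵘ q) ⟨
    toℚᵘ (fromℚᵘ p) ℚᵘ.+ toℚᵘ (fromℚᵘ q)    ≈⟨ toℚᵘ-homo-+ (fromℚᵘ p) (fromℚᵘ q) ⟨
    toℚᵘ (fromℚᵘ p + fromℚᵘ q)              ∎)
    where open ℚᵘ.≃-Reasoning

  fromℚᵘ-homo-* : ∀ p q → fromℚᵘ (p ℚᵘ.* q) ≡ fromℚᵘ p * fromℚᵘ q
  fromℚᵘ-homo-* p q = toℚᵘ-injective (begin
    toℚᵘ (fromℚᵘ (p ℚᵘ.* q))                ≈⟨ toℚᵘ-fromℚᵘ (p ℚᵘ.* q) ⟩
    p ℚᵘ.* q                                ≈⟨ ℚᵘ.*-cong (toℚᵘ-fromℚᵘ p) (toℚᵘ-fromℚᵘ q) ⟨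
    toℚᵘ (fromℚᵘ p) ℚᵘ.* toℚᵘ (fromℚᵘ q)    ≈⟨ toℚᵘ-homo-* (fromℚᵘ p) (fromℚᵘ q) ⟨
    toℚᵘ (fromℚᵘ p * fromℚᵘ q)              ∎)
    where open ℚᵘ.≃-Reasoning

  fromℤ : ℤ → ℚ
  fromℤ i = i / 1

  fromℤ-+ : ∀ i j → fromℤ (i ℤ.+ j) ≡ fromℤ i + fromℤ j
  fromℤ-+ i j = trans (fromℚᵘ-cong {mkℚᵘ (i ℤ.+ j) 0} {mkℚᵘ i 0 ℚᵘ.+ mkℚᵘ j 0} (*≡* i+j≡i*1+j*1))
                      (fromℚᵘ-homo-+ (mkℚᵘ i 0) (mkℚᵘ j 0))
    where
    i+j≡i*1+j*1 : (i ℤ.+ j) ℤ.* + 1 ≡ (i ℤ.* + 1 ℤ.+ j ℤ.* + 1) ℤ.* + 1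
    i+j≡i*1+j*1 = cong (ℤ._* + 1) (sym (cong₂ ℤ._+_ (ℤ.*-identityʳ i) (ℤ.*-identityʳ j)))

  fromℤ-* : ∀ i j → fromℤ (i ℤ.* j) ≡ fromℤ i * fromℤ j
  fromℤ-* i j = fromℚᵘ-homo-* (mkℚᵘ i 0) (mkℚᵘ j 0)

  fromℤ-*³ : ∀ i j k → fromℤ (i ℤ.* j ℤ.* k) ≡ fromℤ i * fromℤ j * fromℤ k
  fromℤ-*³ i j k = trans (fromℤ-* (i ℤ.* j) k) (cong (_* fromℤ k) (fromℤ-* i j))

  ↥-fromℤ : ∀ i → ↥ fromℤ i ≡ i
  ↥-fromℤ i = begin
    ↥ fromℤ i                     ≡⟨ ℤ.*-identityʳ (↥ fromℤ i) ⟨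
    ↥ fromℤ i ℤ.* + 1             ≡⟨ cong (↥ fromℤ i ℤ.*_) (ℤ.gcd-zeroʳ i) ⟨
    ↥ fromℤ i ℤ.* ℤ.gcd i (+ 1)   ≡⟨ ↥-/ i 1 ⟩
    i                             ∎
    where open ≡-Reasoning

  fromℤ-injective : ∀ {i j} → fromℤ i ≡ fromℤ j → i ≡ j
  fromℤ-injective {i} {j} eq = trans (sym (↥-fromℤ i)) (trans (cong ↥_ eq) (↥-fromℤ j))

  *-fromℤ-↧≡fromℤ-↥ : ∀ p → p * fromℤ (↧ p) ≡ fromℤ (↥ p)
  *-fromℤ-↧≡fromℤ-↥ p@(mkℚ n d-1 _) = begin
    p * fromℤ (↧ p)                      ≡⟨ cong (_* fromℤ (↧ p)) (fromℚᵘ-toℚᵘ p) ⟨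
    fromℚᵘ (toℚᵘ p) * fromℤ (↧ p)        ≡⟨ fromℚᵘ-homo-* (toℚᵘ p) (mkℚᵘ (↧ p) 0) ⟨
    fromℚᵘ (toℚᵘ p ℚᵘ.* mkℚᵘ (↧ p) 0)    ≡⟨ fromℚᵘ-cong {toℚᵘ p ℚᵘ.* mkℚᵘ (↧ p) 0} {mkℚᵘ n 0} (*≡* n*↧p≡n*↧p) ⟩
    fromℤ n                              ∎
    where
    open ≡-Reasoning
    n*↧p≡n*↧p : n ℤ.* + suc d-1 ℤ.* + 1 ≡ n ℤ.* + suc (d-1 ℕ.* 1)
    n*↧p≡n*↧p = trans (ℤ.*-identityʳ _) (cong (λ k → n ℤ.* + suc k) (sym (ℕ.*-identityʳ d-1)))

  ÷≡⇒≡* : ∀ p q .{{_ : NonZero q}} {r} → p ÷ q ≡ r → p ≡ r * q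
  ÷≡⇒≡* p q {r} eq = begin
    p                ≡⟨ *-identityʳ p ⟨
    p * 1ℚ           ≡⟨ cong (p *_) (*-inverseˡ q) ⟨
    p * (1/ q * q)   ≡⟨ *-assoc p (1/ q) q ⟨
    p ÷ q * q        ≡⟨ cong (_* q) eq ⟩
    r * q            ∎
    where open ≡-Reasoning

  φ≡⇒numerator≡ : ∀ r s t x {q} → φ r s t x ≡ q → r * s * x ^ 3 + s * x + t ≡ q * (x * x + 1ℚ)
  φ≡⇒numerator≡ r s t x = ÷≡⇒≡* (r * s * x ^ 3 + s * x + t) (x * x + 1ℚ) {{sq+1-nonZero x}}

  scale-numerator≡ : ∀ r s t x q dr ds dt → r * s * x ^ 3 + s * x + t ≡ q * (x * x + 1ℚ) →
    (r * dr) * (s * ds) * dt * (x * x * x) + (s * ds) * dr * dt * x + (t * dt) * dr * ds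
      ≡ q * (dr * ds * dt) * (x * x + 1ℚ)
  scale-numerator≡ r s t x q dr ds dt eq = begin
    (r * dr) * (s * ds) * dt * (x * x * x) + (s * ds) * dr * dt * x + (t * dt) * dr * ds
      ≡⟨ solve 7 (λ r s t x dr ds dt →
           (r :* dr) :* (s :* ds) :* dt :* (x :* x :* x) :+ (s :* ds) :* dr :* dt :* x :+ (t :* dt) :* dr :* ds
           := dr :* ds :* dt :* (r :* s :* (x :* (x :* (x :* con 1ℚ))) :+ s :* x :+ t))
           refl r s t x dr ds dt ⟩
    dr * ds * dt * (r * s * x ^ 3 + s * x + t)
      ≡⟨ cong (dr * ds * dt *_) eq ⟩
    dr * ds * dt * (q * (x * x + 1ℚ))
      ≡⟨ solve 5 (λ q x dr ds dt → dr :* ds :* dt :* (q :* (x :* x :+ con 1ℚ))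
                                   := q :* (dr :* ds :* dt) :* (x :* x :+ con 1ℚ)) refl q x dr ds dt ⟩
    q * (dr * ds * dt) * (x * x + 1ℚ) ∎
    where
    open ≡-Reasoning
    open ℚ-Solver.+-*-Solver

  homogenise : ∀ R S T W x {a} b → x * b ≡ a → R * (x * x * x) + S * x + T ≡ W * (x * x + 1ℚ) →
    R * (a * a * a) + S * a * b * b + T * (b * b * b) ≡ W * b * (a * a + b * b)
  homogenise R S T W x b refl eq = begin
    R * (x * b * (x * b) * (x * b)) + S * (x * b) * b * b + T * (b * b * b)
      ≡⟨ solve 5 (λ R S T x b → R :* (x :* b :* (x :* b) :* (x :* b)) :+ S :* (x :* b) :* b :* b :+ T :* (b :* b :* b)
                               := b :* b :* b :* (R :* (x :* x :* x) :+ S :* x :+ T)) refl R S T x b ⟩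
    b * b * b * (R * (x * x * x) + S * x + T)
      ≡⟨ cong (b * b * b *_) eq ⟩
    b * b * b * (W * (x * x + 1ℚ))
      ≡⟨ solve 3 (λ W x b → b :* b :* b :* (W :* (x :* x :+ con 1ℚ))
                           := W :* b :* (x :* b :* (x :* b) :+ b :* b)) refl W x b ⟩
    W * b * (x * b * (x * b) + b * b) ∎
    where
    open ≡-Reasoning
    open ℚ-Solver.+-*-Solver

module _ where
  open Data.Integer using (_+_; _-_; _*_)

  cubicForm : ℤ → ℤ → ℤ → ℤ → ℤ → ℤ
  cubicForm R S T a b = R * (a * a * a) + S * a * b * b + T * (b * b * b)

  -- F(i, 1) F(−i, 1) = |T + (S − R) i|² for F = cubicForm R S T, i.e. the resultant of F(X, 1) and X² + 1.
  resultant : ℤ → ℤ → ℤ → ℤ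
  resultant R S T = (R - S) * (R - S) + T * T

  i*i≡+∣i∣*∣i∣ : ∀ i → i * i ≡ + (∣ i ∣ ℕ.* ∣ i ∣)
  i*i≡+∣i∣*∣i∣ (+ n)    = ℤ.+◃n≡+n _
  i*i≡+∣i∣*∣i∣ -[1+ n ] = ℤ.+◃n≡+n _

  ∣i*i+j*j∣ : ∀ i j → ∣ i * i + j * j ∣ ≡ ∣ i ∣ ℕ.* ∣ i ∣ ℕ.+ ∣ j ∣ ℕ.* ∣ j ∣
  ∣i*i+j*j∣ i j = cong ∣_∣ (cong₂ _+_ (i*i≡+∣i∣*∣i∣ i) (i*i≡+∣i∣*∣i∣ j))

  n≤n*n : ∀ n → n ≤ n ℕ.* n
  n≤n*n 0         = z≤n
  n≤n*n n@(suc _) = ℕ.m≤m*n n n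

  coprime-sumSq : ∀ {m n} → ℕ.Coprime m n → ℕ.Coprime (m ℕ.* m ℕ.+ n ℕ.* n) n
  coprime-sumSq {m} {n} m⊥n {d} (d∣m²+n² , d∣n) = m⊥n (ℕ.coprime-divisor d⊥m d∣m*m , d∣n)
    where
    d∣m*m : d ℕ.∣ m ℕ.* m
    d∣m*m = ℕ.∣m+n∣m⇒∣n (subst (d ℕ.∣_) (ℕ.+-comm (m ℕ.* m) (n ℕ.* n)) d∣m²+n²) (ℕ.∣n⇒∣m*n n d∣n)
    d⊥m : ℕ.Coprime d m
    d⊥m (e∣d , e∣m) = m⊥n (e∣m , ℕ.∣-trans e∣d d∣n)

  sumSq-coprime : ∀ {a b} → Coprime a b → Coprime (a * a + b * b) b
  sumSq-coprime {a} {b} a⊥b = subst (λ k → ℕ.Coprime k ∣ b ∣) (sym (∣i*i+j*j∣ a b)) (coprime-sumSq a⊥b)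

  -- Modulo a² + b² we have a² ≡ −b², so F(a, b) ≡ b² (T b − (R − S) a), and multiplying by
  -- T b + (R − S) a turns this into b⁴ ((R − S)² + T²).
  b⁴*resultant≡ : ∀ R S T a b w → cubicForm R S T a b ≡ w * (a * a + b * b) →
    b * (b * (b * (b * resultant R S T)))
      ≡ ((w - R * a) * (T * b + (R - S) * a) + b * b * ((R - S) * (R - S))) * (a * a + b * b)
  b⁴*resultant≡ R S T a b w eq = begin
    b * (b * (b * (b * resultant R S T)))
      ≡⟨ solve 5 (λ R S T a b → b :* (b :* (b :* (b :* ((R :- S) :* (R :- S) :+ T :* T))))
           := (R :* (a :* a :* a) :+ S :* a :* b :* b :+ T :* (b :* b :* b) :- R :* a :* (a :* a :+ b :* b))
                :* (T :* b :+ (R :- S) :* a)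
              :+ b :* b :* ((R :- S) :* (R :- S)) :* (a :* a :+ b :* b)) refl R S T a b ⟩
    (cubicForm R S T a b - R * a * m) * (T * b + (R - S) * a) + b * b * ((R - S) * (R - S)) * m
      ≡⟨ cong (λ F → (F - R * a * m) * (T * b + (R - S) * a) + b * b * ((R - S) * (R - S)) * m) eq ⟩
    (w * m - R * a * m) * (T * b + (R - S) * a) + b * b * ((R - S) * (R - S)) * m
      ≡⟨ solve 7 (λ R S T a b w m →
           (w :* m :- R :* a :* m) :* (T :* b :+ (R :- S) :* a) :+ b :* b :* ((R :- S) :* (R :- S)) :* m
           := ((w :- R :* a) :* (T :* b :+ (R :- S) :* a) :+ b :* b :* ((R :- S) :* (R :- S))) :* m)
           refl R S T a b w m ⟩
    ((w - R * a) * (T * b + (R - S) * a) + b * b * ((R - S) * (R - S))) * m ∎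
    where
    open ≡-Reasoning
    open ℤ-Solver.+-*-Solver
    m : ℤ
    m = a * a + b * b

  sumSq∣resultant : ∀ {R S T a b w} → Coprime a b → cubicForm R S T a b ≡ w * (a * a + b * b) →
    (a * a + b * b) ∣ᵤ resultant R S T
  sumSq∣resultant {R} {S} {T} {a} {b} {w} a⊥b eq = cancel-b (cancel-b (cancel-b (cancel-b m∣b⁴K)))
    where
    m : ℤ
    m = a * a + b * b
    m∣b⁴K : m ∣ᵤ b * (b * (b * (b * resultant R S T)))
    m∣b⁴K = ∣⇒∣ᵤ {m} (divides ((w - R * a) * (T * b + (R - S) * a) + b * b * ((R - S) * (R - S)))
                                (b⁴*resultant≡ R S T a b w eq))
    cancel-b : ∀ {k} → m ∣ᵤ b * k → m ∣ᵤ k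
    cancel-b {k} = coprime-divisor m b k (sumSq-coprime {a} {b} a⊥b)

  resultant≢0 : ∀ R S {T} → ¬ T ≡ 0ℤ → ¬ resultant R S T ≡ 0ℤ
  resultant≢0 R S {T} T≢0 K≡0 = T≢0 (ℤ.∣i∣≡0⇒i≡0 ∣T∣≡0)
    where
    ∣T∣*∣T∣≡0 : ∣ T ∣ ℕ.* ∣ T ∣ ≡ 0
    ∣T∣*∣T∣≡0 = ℕ.m+n≡0⇒n≡0 _ (trans (sym (∣i*i+j*j∣ (R - S) T)) (cong ∣_∣ K≡0))
    ∣T∣≡0 : ∣ T ∣ ≡ 0
    ∣T∣≡0 with ℕ.m*n≡0⇒m≡0∨n≡0 ∣ T ∣ ∣T∣*∣T∣≡0
    ... | inj₁ eq = eq
    ... | inj₂ eq = eq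

  sumSq∣⇒bounded : ∀ {a b k} → ¬ k ≡ 0ℤ → (a * a + b * b) ∣ᵤ k → ∣ a ∣ ≤ ∣ k ∣ × ∣ b ∣ ≤ ∣ k ∣
  sumSq∣⇒bounded {a} {b} {k} k≢0 m∣k =
    ℕ.≤-trans (n≤n*n ∣ a ∣) (ℕ.≤-trans (ℕ.m≤m+n _ _) m≤k) ,
    ℕ.≤-trans (n≤n*n ∣ b ∣) (ℕ.≤-trans (ℕ.m≤n+m _ _) m≤k)
    where
    m≤k : ∣ a ∣ ℕ.* ∣ a ∣ ℕ.+ ∣ b ∣ ℕ.* ∣ b ∣ ≤ ∣ k ∣
    m≤k = subst (_≤ ∣ k ∣) (∣i*i+j*j∣ a b) (ℕ.∣⇒≤ {{ℕ.≢-nonZero (k≢0 ∘ ℤ.∣i∣≡0⇒i≡0)}} m∣k)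

module _ where
  open Data.Rational using (_+_; _*_)

  fromℤ-cubicForm : ∀ R S T a b → fromℤ (cubicForm R S T a b)
    ≡ fromℤ R * (fromℤ a * fromℤ a * fromℤ a) + fromℤ S * fromℤ a * fromℤ b * fromℤ b
        + fromℤ T * (fromℤ b * fromℤ b * fromℤ b)
  fromℤ-cubicForm R S T a b =
    trans (fromℤ-+ (R ℤ.* (a ℤ.* a ℤ.* a) ℤ.+ S ℤ.* a ℤ.* b ℤ.* b) (T ℤ.* (b ℤ.* b ℤ.* b)))
      (cong₂ _+_ (trans (fromℤ-+ (R ℤ.* (a ℤ.* a ℤ.* a)) (S ℤ.* a ℤ.* b ℤ.* b))
                        (cong₂ _+_ (fromℤ-*cube R a) fromℤ-Sabb))
                 (fromℤ-*cube T b))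
    where
    fromℤ-*cube : ∀ i j → fromℤ (i ℤ.* (j ℤ.* j ℤ.* j)) ≡ fromℤ i * (fromℤ j * fromℤ j * fromℤ j)
    fromℤ-*cube i j = trans (fromℤ-* i (j ℤ.* j ℤ.* j)) (cong (fromℤ i *_) (fromℤ-*³ j j j))
    fromℤ-Sabb : fromℤ (S ℤ.* a ℤ.* b ℤ.* b) ≡ fromℤ S * fromℤ a * fromℤ b * fromℤ b
    fromℤ-Sabb = trans (fromℤ-* (S ℤ.* a ℤ.* b) b) (cong (_* fromℤ b) (fromℤ-*³ S a b))

  fromℤ-*sumSq : ∀ w a b → fromℤ (w ℤ.* (a ℤ.* a ℤ.+ b ℤ.* b)) ≡ fromℤ w * (fromℤ a * fromℤ a + fromℤ b * fromℤ b)
  fromℤ-*sumSq w a b = trans (fromℤ-* w (a ℤ.* a ℤ.+ b ℤ.* b))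
    (cong (fromℤ w *_) (trans (fromℤ-+ (a ℤ.* a) (b ℤ.* b)) (cong₂ _+_ (fromℤ-* a a) (fromℤ-* b b))))

  cubicForm-↥↧ : ∀ R S T W x → fromℤ R * (x * x * x) + fromℤ S * x + fromℤ T ≡ fromℤ W * (x * x + 1ℚ) →
    cubicForm R S T (↥ x) (↧ x) ≡ W ℤ.* ↧ x ℤ.* (↥ x ℤ.* ↥ x ℤ.+ ↧ x ℤ.* ↧ x)
  cubicForm-↥↧ R S T W x eq = fromℤ-injective (begin
    fromℤ (cubicForm R S T (↥ x) (↧ x))
      ≡⟨ fromℤ-cubicForm R S T (↥ x) (↧ x) ⟩
    fromℤ R * (fromℤ (↥ x) * fromℤ (↥ x) * fromℤ (↥ x)) + fromℤ S * fromℤ (↥ x) * fromℤ (↧ x) * fromℤ (↧ x)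
      + fromℤ T * (fromℤ (↧ x) * fromℤ (↧ x) * fromℤ (↧ x))
      ≡⟨ homogenise (fromℤ R) (fromℤ S) (fromℤ T) (fromℤ W) x (fromℤ (↧ x)) (*-fromℤ-↧≡fromℤ-↥ x) eq ⟩
    fromℤ W * fromℤ (↧ x) * (fromℤ (↥ x) * fromℤ (↥ x) + fromℤ (↧ x) * fromℤ (↧ x))
      ≡⟨ cong (_* _) (fromℤ-* W (↧ x)) ⟨
    fromℤ (W ℤ.* ↧ x) * (fromℤ (↥ x) * fromℤ (↥ x) + fromℤ (↧ x) * fromℤ (↧ x))
      ≡⟨ fromℤ-*sumSq (W ℤ.* ↧ x) (↥ x) (↧ x) ⟨
    fromℤ (W ℤ.* ↧ x ℤ.* (↥ x ℤ.* ↥ x ℤ.+ ↧ x ℤ.* ↧ x)) ∎)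
    where open ≡-Reasoning

boundedInts : ℕ → List ℤ
boundedInts N = map +_ (upTo (suc N)) ++ map -[1+_] (upTo N)

∈-boundedInts : ∀ {N} i → ∣ i ∣ ≤ N → i ∈ boundedInts N
∈-boundedInts (+ n)        n≤N = ∈-++⁺ˡ (∈-map⁺ +_ (∈-upTo⁺ (s≤s n≤N)))
∈-boundedInts {N} -[1+ n ] n<N = ∈-++⁺ʳ (map +_ (upTo (suc N))) (∈-map⁺ -[1+_] (∈-upTo⁺ n<N))

fraction : ℤ → ℕ → ℚ
fraction a d-1 = a / suc d-1

boundedRats : ℕ → List ℚ
boundedRats N = cartesianProductWith fraction (boundedInts N) (upTo N)

∈-boundedRats : ∀ {N} p → ∣ ↥ p ∣ ≤ N → ↧ₙ p ≤ N → p ∈ boundedRats N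
∈-boundedRats {N} p@(mkℚ a _ _) ∣a∣≤N ↧p≤N =
  subst (_∈ boundedRats N) (↥p/↧p≡p p) (∈-cartesianProductWith⁺ fraction (∈-boundedInts a ∣a∣≤N) (∈-upTo⁺ ↧p≤N))

↧≢0 : ∀ p → ¬ ↧ p ≡ 0ℤ
↧≢0 (mkℚ _ _ _) ()

↥↧-coprime : ∀ p → Coprime (↥ p) (↧ p)
↥↧-coprime (mkℚ _ _ c) = ℕ.recompute c

module IntegerValues (r s t : ℚ) where
  open Data.Rational using (_+_; _*_)

  -- D is the product of the denominators of r, s, t, and R, S, T are D r s, D s, D t.
  D R S T : ℤ
  D = ↧ r ℤ.* ↧ s ℤ.* ↧ t
  R = ↥ r ℤ.* ↥ s ℤ.* ↧ t
  S = ↥ s ℤ.* ↧ r ℤ.* ↧ t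
  T = ↥ t ℤ.* ↧ r ℤ.* ↧ s

  φ≡⇒cleared : ∀ {x z} → φ r s t x ≡ fromℤ z →
    fromℤ R * (x * x * x) + fromℤ S * x + fromℤ T ≡ fromℤ (z ℤ.* D) * (x * x + 1ℚ)
  φ≡⇒cleared {x} {z} eq = begin
    fromℤ R * (x * x * x) + fromℤ S * x + fromℤ T
      ≡⟨ cong₂ _+_ (cong₂ _+_ (cong (_* (x * x * x)) fromℤ-R) (cong (_* x) fromℤ-S)) fromℤ-T ⟩
    (r * dr) * (s * ds) * dt * (x * x * x) + (s * ds) * dr * dt * x + (t * dt) * dr * ds
      ≡⟨ scale-numerator≡ r s t x (fromℤ z) dr ds dt (φ≡⇒numerator≡ r s t x eq) ⟩
    fromℤ z * (dr * ds * dt) * (x * x + 1ℚ)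
      ≡⟨ cong (_* (x * x + 1ℚ)) (trans (fromℤ-* z D) (cong (fromℤ z *_) (fromℤ-*³ (↧ r) (↧ s) (↧ t)))) ⟨
    fromℤ (z ℤ.* D) * (x * x + 1ℚ) ∎
    where
    open ≡-Reasoning
    dr ds dt : ℚ
    dr = fromℤ (↧ r)
    ds = fromℤ (↧ s)
    dt = fromℤ (↧ t)
    fromℤ-↥ : ∀ p → fromℤ (↥ p) ≡ p * fromℤ (↧ p)
    fromℤ-↥ p = sym (*-fromℤ-↧≡fromℤ-↥ p)
    fromℤ-R : fromℤ R ≡ (r * dr) * (s * ds) * dt
    fromℤ-R = trans (fromℤ-*³ (↥ r) (↥ s) (↧ t)) (cong₂ (λ u v → u * v * dt) (fromℤ-↥ r) (fromℤ-↥ s))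
    fromℤ-S : fromℤ S ≡ (s * ds) * dr * dt
    fromℤ-S = trans (fromℤ-*³ (↥ s) (↧ r) (↧ t)) (cong (λ u → u * dr * dt) (fromℤ-↥ s))
    fromℤ-T : fromℤ T ≡ (t * dt) * dr * ds
    fromℤ-T = trans (fromℤ-*³ (↥ t) (↧ r) (↧ s)) (cong (λ u → u * dr * ds) (fromℤ-↥ t))

  T≢0 : ¬ t ≡ 0ℚ → ¬ T ≡ 0ℤ
  T≢0 t≢0 T≡0 with ℤ.i*j≡0⇒i≡0∨j≡0 (↥ t ℤ.* ↧ r) T≡0
  ... | inj₂ ↧s≡0 = ↧≢0 s ↧s≡0
  ... | inj₁ ↥t*↧r≡0 with ℤ.i*j≡0⇒i≡0∨j≡0 (↥ t) ↥t*↧r≡0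
  ...   | inj₁ ↥t≡0 = t≢0 (↥p≡0⇒p≡0 t ↥t≡0)
  ...   | inj₂ ↧r≡0 = ↧≢0 r ↧r≡0

  candidates : List ℤ
  candidates = map (↥_ ∘ φ r s t) (boundedRats ∣ resultant R S T ∣)

  integerValue∈candidates : ¬ t ≡ 0ℚ → ∀ {x z} → φ r s t x ≡ fromℤ z → z ∈ candidates
  integerValue∈candidates t≢0 {x} {z} eq =
    subst (_∈ candidates) (trans (cong ↥_ eq) (↥-fromℤ z))
      (∈-map⁺ (↥_ ∘ φ r s t) (uncurry (∈-boundedRats x) bounds))
    where
    sumSq∣K : (↥ x ℤ.* ↥ x ℤ.+ ↧ x ℤ.* ↧ x) ∣ᵤ resultant R S T
    sumSq∣K = sumSq∣resultant {R} {S} {T} {↥ x} {↧ x} {z ℤ.* D ℤ.* ↧ x} (↥↧-coprime x) (cubicForm-↥↧ R S T (z ℤ.* D) x (φ≡⇒cleared {x} {z} eq))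
    bounds : ∣ ↥ x ∣ ≤ ∣ resultant R S T ∣ × ∣ ↧ x ∣ ≤ ∣ resultant R S T ∣
    bounds = sumSq∣⇒bounded {↥ x} {↧ x} (resultant≢0 R S (T≢0 t≢0)) sumSq∣K

iter-fixedPoint : ∀ {f : ℚ → ℚ} {x} → f x ≡ x → ∀ k → iter f k x ≡ x
iter-fixedPoint fx≡x zero = refl
iter-fixedPoint {f} fx≡x (suc k) = trans (cong f (iter-fixedPoint fx≡x k)) fx≡x

module _ where
  open Data.Rational using (_+_; _*_)

  φ[t=0]-fixes-0 : ∀ r s → φ r s 0ℚ 0ℚ ≡ 0ℚ
  φ[t=0]-fixes-0 r s = trans (cong (_* 1/ (0ℚ * 0ℚ + 1ℚ)) numerator≡0) (*-zeroˡ (1/ (0ℚ * 0ℚ + 1ℚ)))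
    where
    open ℚ-Solver.+-*-Solver
    numerator≡0 : r * s * 0ℚ ^ 3 + s * 0ℚ + 0ℚ ≡ 0ℚ
    numerator≡0 = solve 2 (λ r s → r :* s :* (con 0ℚ :* (con 0ℚ :* (con 0ℚ :* con 1ℚ))) :+ s :* con 0ℚ :+ con 0ℚ
                                   := con 0ℚ) refl r s

  β[t=0]≡0 : ∀ n₁ n₂ {n₃} r s → 1 ≤ n₃ → β n₁ n₂ n₃ r s 0ℚ ≡ 0ℚ
  β[t=0]≡0 n₁ n₂ {suc n₃} r s _ = trans (cong (r ^ n₁ * s ^ n₂ *_) (*-zeroˡ (0ℚ ^ n₃))) (*-zeroʳ (r ^ n₁ * s ^ n₂))

lemma3p8 : (n₁ n₂ n₃ : ℕ) → 6 ≤ n₁ → 6 ≤ n₂ → 6 ≤ n₃ →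
    (r s t : ℚ) →
    Σ (List ℤ) (λ L → (k : ℕ) (z : ℤ) →
      iter (φ r s t) k (β n₁ n₂ n₃ r s t) ≡ z / 1 → z ∈ L)
lemma3p8 n₁ n₂ n₃ _ _ 6≤n₃ r s t with t ≟ 0ℚ
... | yes refl = 0ℤ ∷ [] , λ k z eq → here (fromℤ-injective (trans (sym eq) (orbit≡0 k)))
  where
  orbit≡0 : ∀ k → iter (φ r s 0ℚ) k (β n₁ n₂ n₃ r s 0ℚ) ≡ 0ℚ
  orbit≡0 k = trans (cong (iter (φ r s 0ℚ) k) (β[t=0]≡0 n₁ n₂ r s (ℕ.≤-trans (s≤s z≤n) 6≤n₃)))
                    (iter-fixedPoint (φ[t=0]-fixes-0 r s) k)
... | no t≢0 = ↥ β n₁ n₂ n₃ r s t ∷ candidates , orbit∈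
  where
  open IntegerValues r s t
  orbit∈ : ∀ k z → iter (φ r s t) k (β n₁ n₂ n₃ r s t) ≡ fromℤ z → z ∈ ↥ β n₁ n₂ n₃ r s t ∷ candidates
  orbit∈ zero    z eq = here (trans (sym (↥-fromℤ z)) (cong ↥_ (sym eq)))
  orbit∈ (suc k) z eq = there (integerValue∈candidates t≢0 eq)
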